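{- Let $D$ be a digraph of order $n$. Order its vertices as $u_1,\dots,u_n$ so that $deg^+(u_1)\geq deg^+(u_2)\geq\dots\geq deg^+(u_n)$, and let $t^+(D):=\max\{i : deg^+(u_i)\geq i-1\}$, i.e. the maximum number $i$ such that $D$ contains at least $i$ vertices of out-degree at least $i-1$. Order the vertices as $v_1,\dots,v_n$ so that $deg^-(v_1)\geq deg^-(v_2)\geq\dots\geq deg^-(v_n)$, and let $t^-(D):=\max\{i : deg^-(v_i)\geq i-1\}$, i.e. the maximum number $i$ such that $D$ contains at least $i$ vertices of in-degree at least $i-1$. Then \[dib(D)\leq t(D):=\min\{t^+(D),t^-(D)\}.\]
   Context: All digraphs are finite, loopless, and simple: $D=(V,A)$ where $A$ is a set of ordered pairs $uv$ (darts) of distinct vertices; both $uv$ and $vu$ may be darts. $deg^+(u)$ is the number of darts $uw$ and $deg^-(u)$ the number of darts $wu$. A coloring of $D$ with $k$ colors is a surjective map $\varsigma:V\to\{1,\dots,k\}$; it is acyclic if each color class induces a subdigraph with no directed cycle. With respect to $\varsigma$, a vertex $u$ is a $b^+$-vertex if for every color $j\neq\varsigma(u)$ there is a dart $uw$ with $\varsigma(w)=j$, and a $b^-$-vertex if for every color $j\neq \varsigma(u)$ there is a dart $wu$ with $\varsigma(w)=j$. A $b$-coloring is a coloring in which every color class contains a $b^+$-vertex and a $b^-$-vertex. The dib-chromatic number $dib(D)$ is the largest $k$ such that $D$ admits an acyclic $b$-coloring with $k$ colors. -}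

module Defs where

open import Data.Nat using (ℕ; zero; suc; _+_; _∸_; _≤ᵇ_; _≤_)
open import Data.Bool using (Bool; true; false; if_then_else_)
open import Data.Fin using (Fin; zero; suc; inject₁; fromℕ)
open import Data.Empty using (⊥)
open import Data.Product using (Σ; ∃; _×_)
open import Relation.Binary.PropositionalEquality using (_≡_; _≢_)
open import Function using (_∘_)
open import Function.Definitions using (Injective; Surjective)

record Digraph (n : ℕ) : Set where
  field
    arc      : Fin n → Fin n → Bool
    loopless : ∀ u → arc u u ≡ false
open Digraph public

countB : ∀ {n} → (Fin n → Bool) → ℕ
countB {zero}  p = 0
countB {suc n} p = (if p zero then 1 else 0) + countB (p ∘ suc)

outdeg : ∀ {n} → Digraph n → Fin n → ℕ
outdeg D u = countB (λ w → arc D u w)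

indeg : ∀ {n} → Digraph n → Fin n → ℕ
indeg D u = countB (λ w → arc D w u)

-- largest i ≤ m with p i ≡ true (0 if none)
largest : (ℕ → Bool) → ℕ → ℕ
largest p zero    = 0
largest p (suc i) = if p (suc i) then suc i else largest p i

-- t given a degree function: the maximum i such that at least i vertices
-- have degree at least i - 1 (for i = 0 the condition holds trivially;
-- any valid i satisfies i ≤ n, so searching 0..n suffices).
tDeg : ∀ {n} → (Fin n → ℕ) → ℕ
tDeg {n} deg = largest (λ i → i ≤ᵇ countB (λ v → (i ∸ 1) ≤ᵇ deg v)) n

t⁺ : ∀ {n} → Digraph n → ℕ
t⁺ D = tDeg (outdeg D)

t⁻ : ∀ {n} → Digraph n → ℕ
t⁻ D = tDeg (indeg D)

record DirectedCycleIn {n : ℕ} (D : Digraph n) (S : Fin n → Set) : Set where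
  field
    len      : ℕ
    vtx      : Fin (suc len) → Fin n
    distinct : Injective _≡_ _≡_ vtx
    inS      : ∀ i → S (vtx i)
    step     : ∀ (i : Fin len) → arc D (vtx (inject₁ i)) (vtx (suc i)) ≡ true
    close    : arc D (vtx (fromℕ len)) (vtx zero) ≡ true

IsColoring : ∀ {n} (k : ℕ) → (Fin n → Fin k) → Set
IsColoring k ς = Surjective _≡_ _≡_ ς

IsAcyclic : ∀ {n k} → Digraph n → (Fin n → Fin k) → Set
IsAcyclic D ς = ∀ c → DirectedCycleIn D (λ v → ς v ≡ c) → ⊥

IsB⁺ : ∀ {n k} → Digraph n → (Fin n → Fin k) → Fin n → Set
IsB⁺ D ς u = ∀ j → j ≢ ς u → ∃ λ w → arc D u w ≡ true × ς w ≡ j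

IsB⁻ : ∀ {n k} → Digraph n → (Fin n → Fin k) → Fin n → Set
IsB⁻ D ς u = ∀ j → j ≢ ς u → ∃ λ w → arc D w u ≡ true × ς w ≡ j

IsBColoring : ∀ {n k} → Digraph n → (Fin n → Fin k) → Set
IsBColoring D ς =
  IsColoring _ ς ×
  (∀ c → (∃ λ u → ς u ≡ c × IsB⁺ D ς u) × (∃ λ u → ς u ≡ c × IsB⁻ D ς u))

AdmitsAcyclicBColoring : ∀ {n} → Digraph n → ℕ → Set
AdmitsAcyclicBColoring D k =
  Σ (_ → Fin k) λ ς → IsAcyclic D ς × IsBColoring D ς

-- A b⁺-vertex of a colouring with k colours has an out-neighbour of each of
-- the other k − 1 colours, and these neighbours are distinct, so its
-- out-degree is at least k − 1.  Choosing one b⁺-vertex in every colour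
-- class gives k distinct vertices of out-degree at least k − 1, hence
-- k ≤ t⁺(D); the same argument with b⁻-vertices and in-degrees gives k ≤ t⁻(D).
module Submission where

open import Defs
open import Data.Nat using (ℕ; _≤_; _⊓_; zero; suc; _∸_; _≤ᵇ_; z≤n; s≤s; s≤s⁻¹)
open import Data.Nat.Properties using (≤-trans; ≤⇒≤ᵇ; ⊓-glb; m≤n⇒m<n∨m≡n; m≤n⇒m≤1+n)
open import Data.Bool using (Bool; true; false)
open import Data.Bool.Properties using (T-≡)
open import Data.Fin using (Fin; zero; suc; punchIn)
open import Data.Fin.Properties using (injective⇒≤; suc-injective; punchIn-injective; punchInᵢ≢i)
open import Data.Product using (∃; _×_; _,_; proj₁; proj₂)
open import Data.Sum using (inj₁; inj₂)
open import Relation.Nullary using (contradiction)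
open import Relation.Binary.PropositionalEquality using (_≡_; _≢_; refl; sym; trans; cong)
open import Function using (_∘_)
open import Function.Bundles using (Equivalence)
open import Function.Definitions using (Injective)

factor-injective : ∀ {A B C : Set} {f : A → B} (g : B → C) {h : A → C} →
                   (∀ x → g (f x) ≡ h x) → Injective _≡_ _≡_ h → Injective _≡_ _≡_ f
factor-injective g {h} gf≡h h-inj {x} {y} fx≡fy =
  h-inj (trans (sym (gf≡h x)) (trans (cong g fx≡fy) (gf≡h y)))

≤ᵇ-true : ∀ {m n} → m ≤ n → (m ≤ᵇ n) ≡ true
≤ᵇ-true = Equivalence.to T-≡ ∘ ≤⇒≤ᵇ

countB-≤ : ∀ {n} (p : Fin n → Bool) → countB p ≤ n
countB-≤ {zero}  p = z≤n
countB-≤ {suc n} p with p zero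
... | true  = s≤s (countB-≤ (p ∘ suc))
... | false = m≤n⇒m≤1+n (countB-≤ (p ∘ suc))

rank : ∀ {n} (p : Fin n → Bool) (x : Fin n) → p x ≡ true → Fin (countB p)
rank p zero px with p zero
... | true = zero
rank p (suc x) px with p zero
... | true  = suc (rank (p ∘ suc) x px)
... | false = rank (p ∘ suc) x px

rank-injective : ∀ {n} (p : Fin n → Bool) {x y : Fin n} (px : p x ≡ true) (py : p y ≡ true) →
                 rank p x px ≡ rank p y py → x ≡ y
rank-injective p {zero}  {zero}  px py eq = refl
rank-injective p {zero}  {suc y} px py eq with p zero
rank-injective p {zero}  {suc y} px py () | true
rank-injective p {suc x} {zero}  px py eq with p zero
rank-injective p {suc x} {zero}  px py () | true
rank-injective p {suc x} {suc y} px py eq with p zero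
... | true  = cong suc (rank-injective (p ∘ suc) px py (suc-injective eq))
... | false = cong suc (rank-injective (p ∘ suc) px py eq)

≤-countB : ∀ {m n} (p : Fin n → Bool) (g : Fin m → Fin n) →
           Injective _≡_ _≡_ g → (∀ x → p (g x) ≡ true) → m ≤ countB p
≤-countB p g g-inj pg =
  injective⇒≤ {f = λ x → rank p (g x) (pg x)} (g-inj ∘ rank-injective p (pg _) (pg _))

≤-largest : ∀ (p : ℕ → Bool) {i} m → i ≤ m → p i ≡ true → i ≤ largest p m
≤-largest p zero    z≤n  _  = z≤n
≤-largest p (suc m) i≤1+m pi with p (suc m) in p[1+m]
... | true  = i≤1+m
... | false with m≤n⇒m<n∨m≡n i≤1+m
...   | inj₁ i<1+m = ≤-largest p m (s≤s⁻¹ i<1+m) pi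
...   | inj₂ refl  = contradiction (trans (sym pi) p[1+m]) λ ()

≤-tDeg : ∀ {n k} (deg : Fin n → ℕ) (f : Fin k → Fin n) → Injective _≡_ _≡_ f →
         (∀ c → k ∸ 1 ≤ deg (f c)) → k ≤ tDeg deg
≤-tDeg {n} {k} deg f f-inj k∸1≤deg =
  ≤-largest _ n (≤-trans k≤count (countB-≤ _)) (≤ᵇ-true k≤count)
  where
  k≤count : k ≤ countB (λ v → (k ∸ 1) ≤ᵇ deg v)
  k≤count = ≤-countB _ f f-inj (≤ᵇ-true ∘ k∸1≤deg)

≤-tDeg-representatives : ∀ {n k} (deg : Fin n → ℕ) (ς : Fin n → Fin k) →
                         (∀ c → ∃ λ u → ς u ≡ c × k ∸ 1 ≤ deg u) → k ≤ tDeg deg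
≤-tDeg-representatives deg ς rep =
  ≤-tDeg deg (proj₁ ∘ rep) (factor-injective ς (proj₁ ∘ proj₂ ∘ rep) (λ eq → eq))
    (proj₂ ∘ proj₂ ∘ rep)

∸1-≤-countB : ∀ {n k} (ς : Fin n → Fin k) (p : Fin n → Bool) (c : Fin k) →
              (∀ j → j ≢ c → ∃ λ w → p w ≡ true × ς w ≡ j) → k ∸ 1 ≤ countB p
∸1-≤-countB {k = suc _} ς p c hit =
  ≤-countB p (proj₁ ∘ other) (factor-injective ς (proj₂ ∘ proj₂ ∘ other) (punchIn-injective c _ _))
    (proj₁ ∘ proj₂ ∘ other)
  where
  other : ∀ i → ∃ λ w → p w ≡ true × ς w ≡ punchIn c i
  other i = hit (punchIn c i) (punchInᵢ≢i c i)

b⁺-vertex-outdeg : ∀ {n k} (D : Digraph n) (ς : Fin n → Fin k) {u} → IsB⁺ D ς u → k ∸ 1 ≤ outdeg D u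
b⁺-vertex-outdeg D ς {u} = ∸1-≤-countB ς (arc D u) (ς u)

b⁻-vertex-indeg : ∀ {n k} (D : Digraph n) (ς : Fin n → Fin k) {u} → IsB⁻ D ς u → k ∸ 1 ≤ indeg D u
b⁻-vertex-indeg D ς {u} = ∸1-≤-countB ς (λ w → arc D w u) (ς u)

theorem1 : ∀ {n : ℕ} (D : Digraph n) (k : ℕ) →
           AdmitsAcyclicBColoring D k → k ≤ t⁺ D ⊓ t⁻ D
theorem1 D k (ς , _ , _ , b) = ⊓-glb
  (≤-tDeg-representatives (outdeg D) ς λ c →
     let u , ςu≡c , b⁺ = proj₁ (b c) in u , ςu≡c , b⁺-vertex-outdeg D ς b⁺)
  (≤-tDeg-representatives (indeg D) ς λ c →
     let u , ςu≡c , b⁻ = proj₂ (b c) in u , ςu≡c , b⁻-vertex-indeg D ς b⁻)
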